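{- Let $m'$ be an integer with $m'\not\equiv3,6\pmod9$. Then there exist integers $x_1,x_2,x_3,x_4$ such that $m'\equiv x_1^2+x_2^2+x_3^2+x_4^2\pmod{27}$, $x_1^2+x_2^2\not\equiv1\pmod3$, $x_3^2+x_4^2\not\equiv1\pmod3$, $x_1^2+x_2^2\not\equiv0\pmod{27}$ and $x_3^2+x_4^2\not\equiv0\pmod{27}$. -}

module Defs where

open import Data.Integer using (ℤ; _-_; +_)
open import Data.Integer.Divisibility using (_∣_)
open import Data.Nat using (ℕ)

_≡_[mod_] : ℤ → ℤ → ℕ → Set
a ≡ b [mod n ] = (+ n) ∣ (a - b)

infix 4 _≡_[mod_]

module Submission where

-- Whether an integer m′ admits the required representation
-- depends only on m′ modulo 27: the four squares can be kept fixed while m′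
-- moves inside its residue class, since only the first condition mentions m′.
-- So it suffices to treat the 27 residues r = 0, …, 26.  If r ≡ 3 or 6
-- (mod 9) then so is m′, contradicting the hypotheses; for each of the other
-- 21 residues an explicit quadruple of small squares is listed in a table.

open import Defs
open import Data.Integer using (ℤ; _+_; _*_; +_; _-_; ∣_∣)
open import Data.Integer.Properties using (+-minus-telescope)
open import Data.Integer.DivMod using (_%ℕ_; _/ℕ_; a≡a%ℕn+[a/ℕn]*n; n%ℕd<d)
import Data.Integer.Divisibility.Signed as Signed
open import Data.Integer.Tactic.RingSolver using (solve-∀)
open import Data.Nat as ℕ using (ℕ; NonZero)
import Data.Nat.Divisibility as ℕ
open import Data.Fin using (Fin; toℕ; fromℕ<)
open import Data.Vec using (Vec; _∷_; []; lookup)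
open import Data.Fin.Properties using (all?; toℕ-fromℕ<)
open import Data.Product using (∃-syntax; _×_; _,_)
open import Data.Sum using (_⊎_; inj₁; inj₂)
open import Data.Empty using (⊥-elim)
open import Data.Unit using (tt)
open import Relation.Nullary using (¬_; Dec; ¬?)
open import Relation.Nullary.Decidable using (toWitness; _×-dec_; _⊎-dec_)
open import Relation.Binary.PropositionalEquality using (_≡_; refl; sym; subst)

infix 4 _≡?_[mod_]

_≡?_[mod_] : (a b : ℤ) (n : ℕ) → Dec (a ≡ b [mod n ])
a ≡? b [mod n ] = n ℕ.∣? ∣ a - b ∣

≡-mod-trans : ∀ a b c {n} → a ≡ b [mod n ] → b ≡ c [mod n ] → a ≡ c [mod n ]
≡-mod-trans a b c {n} a≡b b≡c = Signed.∣⇒∣ᵤ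
  (subst (+ n Signed.∣_) (+-minus-telescope a b c)
    (Signed.∣m∣n⇒∣m+n (Signed.∣ᵤ⇒∣ {+ n} {a - b} a≡b) (Signed.∣ᵤ⇒∣ {+ n} {b - c} b≡c)))

≡-mod-divisor : ∀ a b {d n} → d ℕ.∣ n → a ≡ b [mod n ] → a ≡ b [mod d ]
≡-mod-divisor a b = ℕ.∣-trans

≡-mod-remainder : ∀ (m : ℤ) n .{{_ : NonZero n}} → m ≡ + (m %ℕ n) [mod n ]
≡-mod-remainder m n = Signed.∣⇒∣ᵤ
  (subst (+ n Signed.∣_) (sym (difference m (m %ℕ n) (m /ℕ n) (a≡a%ℕn+[a/ℕn]*n m n)))
    (Signed.∣n⇒∣m*n (m /ℕ n) Signed.∣-refl))
  where
  difference : ∀ m r q → m ≡ + r + q * + n → m - + r ≡ q * + n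
  difference m r q refl = cancel (+ r) q (+ n)
    where
    cancel : ∀ (r q n : ℤ) → (r + q * n) - r ≡ q * n
    cancel = solve-∀

9∣27 : 9 ℕ.∣ 27
9∣27 = ℕ.divides 3 refl

SplitSquares : ℤ → ℤ → ℤ → ℤ → ℤ → Set
SplitSquares m x₁ x₂ x₃ x₄ =
  (m ≡ x₁ * x₁ + x₂ * x₂ + x₃ * x₃ + x₄ * x₄ [mod 27 ])
  × ¬ (x₁ * x₁ + x₂ * x₂ ≡ + 1 [mod 3 ])
  × ¬ (x₃ * x₃ + x₄ * x₄ ≡ + 1 [mod 3 ])
  × ¬ (x₁ * x₁ + x₂ * x₂ ≡ + 0 [mod 27 ])
  × ¬ (x₃ * x₃ + x₄ * x₄ ≡ + 0 [mod 27 ])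

Quadruple : Set
Quadruple = ℤ × ℤ × ℤ × ℤ

SplitBy : ℤ → Quadruple → Set
SplitBy m (x₁ , x₂ , x₃ , x₄) = SplitSquares m x₁ x₂ x₃ x₄

splitBy? : ∀ m q → Dec (SplitBy m q)
splitBy? m (x₁ , x₂ , x₃ , x₄) =
  (m ≡? x₁ * x₁ + x₂ * x₂ + x₃ * x₃ + x₄ * x₄ [mod 27 ])
  ×-dec ¬? (x₁ * x₁ + x₂ * x₂ ≡? + 1 [mod 3 ])
  ×-dec ¬? (x₃ * x₃ + x₄ * x₄ ≡? + 1 [mod 3 ])
  ×-dec ¬? (x₁ * x₁ + x₂ * x₂ ≡? + 0 [mod 27 ])
  ×-dec ¬? (x₃ * x₃ + x₄ * x₄ ≡? + 0 [mod 27 ])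

splitBy-mod : ∀ m m′ q → m ≡ m′ [mod 27 ] → SplitBy m′ q → SplitBy m q
splitBy-mod m m′ (x₁ , x₂ , x₃ , x₄) m≡m′ (m′≡sum , rest) =
  ≡-mod-trans m m′ (x₁ * x₁ + x₂ * x₂ + x₃ * x₃ + x₄ * x₄) m≡m′ m′≡sum , rest

split-witness : ∀ m q → SplitBy m q → ∃[ x₁ ] ∃[ x₂ ] ∃[ x₃ ] ∃[ x₄ ] SplitSquares m x₁ x₂ x₃ x₄
split-witness m (x₁ , x₂ , x₃ , x₄) split = x₁ , x₂ , x₃ , x₄ , split

-- Quadruples for the residues r = 0, …, 26 modulo 27 (row i lists r = 3i,
-- 3i + 1, 3i + 2).  Mostly the first half is 9 = 0² + 3² or 2 = 1² + 1², both
-- ≢ 0, 1 (mod 3), and the second half makes up the rest of r.  The residues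
-- r ≡ 3, 6 (mod 9) are excluded by the lemma; their entry is a placeholder.
squares-table : Vec Quadruple 27
squares-table =
    (+ 0 , + 3 , + 3 , + 3) ∷ (+ 1 , + 1 , + 1 , + 5) ∷ (+ 0 , + 3 , + 2 , + 4)
  ∷ excluded              ∷ (+ 1 , + 1 , + 1 , + 1) ∷ (+ 0 , + 3 , + 1 , + 7)
  ∷ excluded              ∷ (+ 1 , + 1 , + 1 , + 2) ∷ (+ 0 , + 3 , + 1 , + 5)
  ∷ (+ 3 , + 3 , + 3 , + 3) ∷ (+ 1 , + 1 , + 2 , + 2) ∷ (+ 0 , + 3 , + 1 , + 1)
  ∷ excluded              ∷ (+ 1 , + 1 , + 1 , + 8) ∷ (+ 0 , + 3 , + 1 , + 2)
  ∷ excluded              ∷ (+ 1 , + 1 , + 2 , + 8) ∷ (+ 0 , + 3 , + 2 , + 2)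
  ∷ (+ 0 , + 3 , + 0 , + 3) ∷ (+ 1 , + 1 , + 1 , + 4) ∷ (+ 0 , + 3 , + 1 , + 8)
  ∷ excluded              ∷ (+ 1 , + 1 , + 2 , + 4) ∷ (+ 0 , + 3 , + 2 , + 8)
  ∷ excluded              ∷ (+ 1 , + 1 , + 1 , + 7) ∷ (+ 0 , + 3 , + 1 , + 4)
  ∷ []
  where
  excluded : Quadruple
  excluded = + 0 , + 0 , + 0 , + 0

ResidueCase : Fin 27 → Set
ResidueCase r = (+ toℕ r ≡ + 3 [mod 9 ]) ⊎ (+ toℕ r ≡ + 6 [mod 9 ])
  ⊎ SplitBy (+ toℕ r) (lookup squares-table r)

residueCase? : ∀ r → Dec (ResidueCase r)
residueCase? r = (+ toℕ r ≡? + 3 [mod 9 ]) ⊎-dec (+ toℕ r ≡? + 6 [mod 9 ])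
  ⊎-dec splitBy? (+ toℕ r) (lookup squares-table r)

-- The definition is opaque so that the type checker never
-- unfolds the evaluated proof when table-correct is used.
opaque
  table-correct : ∀ r → ResidueCase r
  table-correct = toWitness {a? = all? residueCase?} tt

residue : ℤ → Fin 27
residue m = fromℕ< (n%ℕd<d m 27)

≡-mod-residue : ∀ m → m ≡ + toℕ (residue m) [mod 27 ]
≡-mod-residue m = subst (λ r → m ≡ + r [mod 27 ]) (sym (toℕ-fromℕ< (n%ℕd<d m 27)))
  (≡-mod-remainder m 27)

residue-mod-9 : ∀ m t → + toℕ (residue m) ≡ t [mod 9 ] → m ≡ t [mod 9 ]
residue-mod-9 m t =
  ≡-mod-trans m r t (≡-mod-divisor m r 9∣27 (≡-mod-residue m))
  where
  r : ℤ
  r = + toℕ (residue m)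

lemma3p5 : (m′ : ℤ) → ¬ (m′ ≡ + 3 [mod 9 ]) → ¬ (m′ ≡ + 6 [mod 9 ])
    → ∃[ x₁ ] ∃[ x₂ ] ∃[ x₃ ] ∃[ x₄ ]
        ( (m′ ≡ x₁ * x₁ + x₂ * x₂ + x₃ * x₃ + x₄ * x₄ [mod 27 ])
        × ¬ (x₁ * x₁ + x₂ * x₂ ≡ + 1 [mod 3 ])
        × ¬ (x₃ * x₃ + x₄ * x₄ ≡ + 1 [mod 3 ])
        × ¬ (x₁ * x₁ + x₂ * x₂ ≡ + 0 [mod 27 ])
        × ¬ (x₃ * x₃ + x₄ * x₄ ≡ + 0 [mod 27 ]) )
lemma3p5 m′ m′≢3 m′≢6 with table-correct (residue m′)
... | inj₁ r≡3 = ⊥-elim (m′≢3 (residue-mod-9 m′ (+ 3) r≡3))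
... | inj₂ (inj₁ r≡6) = ⊥-elim (m′≢6 (residue-mod-9 m′ (+ 6) r≡6))
... | inj₂ (inj₂ r-split) = split-witness m′ entry
  (splitBy-mod m′ (+ toℕ (residue m′)) entry (≡-mod-residue m′) r-split)
  where
  entry : Quadruple
  entry = lookup squares-table (residue m′)
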